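{- Let $p\geq5$ be a prime number and $n$ a positive divisor of $p-1$; fix a primitive $n$-th root of unity $\zeta_n\in\mathbb{F}_p^\times$ and for $j\in\mathbb{Z}/n$ let $\chi^j_{p,n}:\mathbb{Z}/n\to\mathbb{F}_p^\times$, $1\bmod n\mapsto\zeta_n^j$. Let $j_1,j_2\in\mathbb{Z}/n$ and $a\in\mathbb{F}_p^\times$, and consider the representation $\chi^{j_1}_{p,n}\oplus\chi^{j_2}_{p,n}$ on $\mathbb{F}_p^{2}$ with $H'=\{0\}$ and $L=\langle(1,a)\rangle_{\mathbb{F}_p}$. (i) If $n=\ell$ is an odd prime, this representation satisfies (B) and (C) if and only if $j_1\neq0$, $j_2\neq0$ and $j_1-j_2\neq0$ in $\mathbb{Z}/\ell$. (ii) If $p\equiv1\pmod 4$ and $n=4$, this representation satisfies (B) and (C) if and only if $j_1,j_2\neq0$ and $j_1-j_2\notin\{0,2\}$ in $\mathbb{Z}/4$.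
   Context: For a representation $V$ of a finite group $G'$, a subgroup $H'$ and an $H'$-stable line $L\subset V$: condition (B) is $V^{G'}=\{0\}$; condition (C) is that the stabilizer of $L$ in $G'$ acts trivially on $L$. -}

module Defs where

open import Data.Nat using (ℕ; zero; suc; _+_; _*_; _^_; _<_; _%_)
open import Data.Fin using (Fin; toℕ)
open import Data.Product using (Σ; _×_; _,_)
open import Relation.Nullary using (¬_)
open import Relation.Binary.PropositionalEquality using (_≡_)
import Data.Integer as ℤ
open import Data.Integer.Divisibility using () renaming (_∣_ to _∣ℤ_)

-- Congruence of natural numbers modulo p: p divides x - y in ℤ.
-- Elements of 𝔽_p are represented by natural numbers up to this congruence.
infix 4 _≡_[mod_]
_≡_[mod_] : ℕ → ℕ → ℕ → Set
x ≡ y [mod p ] = ℤ.+ p ∣ℤ (ℤ.+ x ℤ.- ℤ.+ y)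

PrimitiveRoot : (p n ζ : ℕ) → Set
PrimitiveRoot p n ζ = (ζ ^ n ≡ 1 [mod p ]) × (∀ k → 0 < k → k < n → ¬ (ζ ^ k ≡ 1 [mod p ]))

-- Vectors of 𝔽_p², represented by pairs of naturals; equality is componentwise mod p.
V2 : Set
V2 = ℕ × ℕ

infix 4 _≈[_]_
_≈[_]_ : V2 → ℕ → V2 → Set
(x₁ , y₁) ≈[ p ] (x₂ , y₂) = (x₁ ≡ x₂ [mod p ]) × (y₁ ≡ y₂ [mod p ])

χ⊕χ : {n : ℕ} (ζ : ℕ) (j₁ j₂ : Fin n) → Fin n → V2 → V2
χ⊕χ ζ j₁ j₂ g (x , y) = (ζ ^ (toℕ j₁ * toℕ g) * x , ζ ^ (toℕ j₂ * toℕ g) * y)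

CondB : (p n : ℕ) → (Fin n → V2 → V2) → Set
CondB p n act = ∀ (v : V2) → (∀ (g : Fin n) → act g v ≈[ p ] v) → v ≈[ p ] (0 , 0)

Line : ℕ → ℕ → V2 → Set
Line p a v = Σ ℕ λ t → v ≈[ p ] (t , t * a)

Stabilizes : (p n : ℕ) → (Fin n → V2 → V2) → (V2 → Set) → Fin n → Set
Stabilizes p n act L g =
  (∀ v → L v → L (act g v)) ×
  (∀ w → L w → Σ V2 λ v → L v × (act g v ≈[ p ] w))

CondC : (p n : ℕ) → (Fin n → V2 → V2) → (V2 → Set) → Set
CondC p n act L = ∀ (g : Fin n) → Stabilizes p n act L g → ∀ v → L v → act g v ≈[ p ] v

{-# OPTIONS --safe #-}
module Submission where

-- Write eᵢ(g) = jᵢ g. Since ζ has order exactly n, ζ^A ≡ ζ^B (mod p) iff A ≡ B (mod n).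
-- (B) holds iff both characters are nontrivial: a trivial χ^{jᵢ} fixes a coordinate axis,
-- while a nontrivial one moves every nonzero point under the generator 1 ∈ ℤ/n.
-- As a ≢ 0, g maps L = ⟨(1,a)⟩ onto itself iff ζ^{e₁(g)} ≡ ζ^{e₂(g)}, and it then acts on L
-- by ζ^{e₁(g)}; so (C) says ker χ^{j₁−j₂} ⊆ ker χ^{j₁}. For ℓ prime, χ^{j₁−j₂} is injective
-- unless j₁ = j₂, and ker χ^{j₁} = ℤ/ℓ only when j₁ = 0; for n = 4 the inclusion is decided
-- by evaluating all sixteen pairs (j₁, j₂).

open import Defs
open import Data.Nat using (ℕ; suc; pred; s≤s; z≤n; _+_; _*_; _^_; _<_; _≤_; _∸_; _%_; _/_; NonZero)
open import Data.Nat.Base using (≢-nonZero; nonTrivial⇒n>1)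
open import Data.Nat.Properties
open import Data.Nat.DivMod using (m≡m%n+[m/n]*n; m%n≤m; m%n<n)
open import Data.Nat.Divisibility using (_∣_; _∣?_; _∣0; n∣m*n; ∣⇒≤)
open import Data.Nat.Primality using (Prime; euclidsLemma; prime⇒nonTrivial; prime⇒nonZero)
open import Data.Integer as ℤ using (ℤ; +_; _⊖_; ∣_∣)
import Data.Integer.Properties as ℤ
import Data.Integer.Divisibility.Signed as ℤ
open import Data.Integer.Tactic.RingSolver using (solve-∀)
open import Data.Fin using (Fin; toℕ; fromℕ<; zero)
import Data.Fin.Properties as Fin
open import Data.Fin.Properties using (toℕ<n; toℕ-fromℕ<; toℕ-injective; all?)
open import Data.Sum using (_⊎_; inj₁; inj₂; [_,_]′)
open import Data.Product using (Σ; _×_; _,_; proj₁; proj₂)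
open import Function.Bundles using (_⇔_; mk⇔; Equivalence)
open import Function.Construct.Composition using (_⇔-∘_)
open import Data.Product.Function.NonDependent.Propositional using (_×-⇔_)
open import Relation.Nullary using (¬_; Dec; yes; no; contradiction; ¬?; _×-dec_; _→-dec_)
open import Relation.Nullary.Decidable using (map′; toWitness)
open import Relation.Binary.Bundles using (Setoid)
open import Relation.Binary.PropositionalEquality using (_≡_; _≢_; refl; sym; trans; cong; subst; module ≡-Reasoning)
import Relation.Binary.Reasoning.Setoid

∣∧<⇒≡0 : ∀ {d m} → d ∣ m → m < d → m ≡ 0
∣∧<⇒≡0 {m = m} d∣m m<d with m ≟ 0
... | yes m≡0 = m≡0
... | no m≢0 = contradiction (∣⇒≤ {{≢-nonZero m≢0}} d∣m) (<⇒≱ m<d)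

module Congruence (n : ℕ) where

  -- A wrapper around _≡_[mod_], which is not injective in x and y, so that they can be inferred.
  infix 4 _≈_
  record _≈_ (x y : ℕ) : Set where
    constructor congruent
    field ≡[mod] : x ≡ y [mod n ]
  open _≈_ public

  private
    Dvd : ℤ → Set
    Dvd z = + n ℤ.∣ z

    fromDvd : ∀ {x y} → Dvd (+ x ℤ.- + y) → x ≈ y
    fromDvd d = congruent (ℤ.∣⇒∣ᵤ d)

    toDvd : ∀ {x y} → x ≈ y → Dvd (+ x ℤ.- + y)
    toDvd (congruent d) = ℤ.∣ᵤ⇒∣ d

    ≈⇔∣⊖∣ : ∀ x y → x ≈ y ⇔ n ∣ ∣ x ⊖ y ∣
    ≈⇔∣⊖∣ x y = mk⇔ (λ e → subst (n ∣_) (cong ∣_∣ (ℤ.m-n≡m⊖n x y)) (≡[mod] e))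
                   (λ d → congruent (subst (n ∣_) (cong ∣_∣ (sym (ℤ.m-n≡m⊖n x y))) d))

  ≈⇔∣∸ : ∀ {x y} → x ≤ y → x ≈ y ⇔ n ∣ y ∸ x
  ≈⇔∣∸ {x} {y} x≤y = mk⇔ (λ e → subst (n ∣_) ∣x⊖y∣≡y∸x (Equivalence.to (≈⇔∣⊖∣ x y) e))
                         (λ d → Equivalence.from (≈⇔∣⊖∣ x y) (subst (n ∣_) (sym ∣x⊖y∣≡y∸x) d))
    where
    ∣x⊖y∣≡y∸x : ∣ x ⊖ y ∣ ≡ y ∸ x
    ∣x⊖y∣≡y∸x = ℤ.∣⊖∣-≤ x≤y

  ≈-refl : ∀ {x} → x ≈ x
  ≈-refl {x} = Equivalence.from (≈⇔∣⊖∣ x x) (subst (n ∣_) (sym (cong ∣_∣ (ℤ.n⊖n≡0 x))) (n ∣0))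

  ≈-sym : ∀ {x y} → x ≈ y → y ≈ x
  ≈-sym {x} {y} e =
    Equivalence.from (≈⇔∣⊖∣ y x) (subst (n ∣_) (ℤ.∣m⊖n∣≡∣n⊖m∣ x y) (Equivalence.to (≈⇔∣⊖∣ x y) e))

  ≈-trans : ∀ {x y z} → x ≈ y → y ≈ z → x ≈ z
  ≈-trans {x} {y} {z} e f = fromDvd (subst Dvd (telescope (+ x) (+ y) (+ z)) (ℤ.∣m∣n⇒∣m+n (toDvd e) (toDvd f)))
    where
    telescope : ∀ a b c → (a ℤ.- b) ℤ.+ (b ℤ.- c) ≡ a ℤ.- c
    telescope = solve-∀

  ≡⇒≈ : ∀ {x y} → x ≡ y → x ≈ y
  ≡⇒≈ refl = ≈-refl

  ≈-setoid : Setoid _ _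
  ≈-setoid = record
    { Carrier       = ℕ
    ; _≈_           = _≈_
    ; isEquivalence = record { refl = ≈-refl ; sym = ≈-sym ; trans = ≈-trans }
    }

  *-cong : ∀ {a b c d} → a ≈ b → c ≈ d → a * c ≈ b * d
  *-cong {a} {b} {c} {d} e f =
    fromDvd (subst Dvd expand (ℤ.∣m∣n⇒∣m+n (ℤ.∣m⇒∣m*n (+ c) (toDvd e)) (ℤ.∣n⇒∣m*n (+ b) (toDvd f))))
    where
    split : ∀ a b c d → (a ℤ.- b) ℤ.* c ℤ.+ b ℤ.* (c ℤ.- d) ≡ a ℤ.* c ℤ.- b ℤ.* d
    split = solve-∀
    expand : (+ a ℤ.- + b) ℤ.* + c ℤ.+ + b ℤ.* (+ c ℤ.- + d) ≡ + (a * c) ℤ.- + (b * d)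
    expand rewrite ℤ.pos-* a c | ℤ.pos-* b d = split (+ a) (+ b) (+ c) (+ d)

  *-congˡ : ∀ a {b c} → b ≈ c → a * b ≈ a * c
  *-congˡ a = *-cong (≈-refl {a})

  *-congʳ : ∀ c {a b} → a ≈ b → a * c ≈ b * c
  *-congʳ c e = *-cong e (≈-refl {c})

  ^-cong : ∀ {a b} k → a ≈ b → a ^ k ≈ b ^ k
  ^-cong 0       e = ≈-refl
  ^-cong (suc k) e = *-cong e (^-cong k e)

  ≤-<-≈⇒≡ : ∀ {x y} → x ≤ y → y < n → x ≈ y → x ≡ y
  ≤-<-≈⇒≡ {x} {y} x≤y y<n e = ≤-antisym x≤y (m∸n≡0⇒m≤n y∸x≡0)
    where
    y∸x≡0 : y ∸ x ≡ 0
    y∸x≡0 = ∣∧<⇒≡0 (Equivalence.to (≈⇔∣∸ x≤y) e) (≤-<-trans (m∸n≤m y x) y<n)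

  <-≈⇒≡ : ∀ {x y} → x < n → y < n → x ≈ y → x ≡ y
  <-≈⇒≡ {x} {y} x<n y<n e with ≤-total x y
  ... | inj₁ x≤y = ≤-<-≈⇒≡ x≤y y<n e
  ... | inj₂ y≤x = sym (≤-<-≈⇒≡ y≤x x<n (≈-sym e))

  %-≈ : ∀ m .{{_ : NonZero n}} → m % n ≈ m
  %-≈ m = Equivalence.from (≈⇔∣∸ (m%n≤m m n)) (subst (n ∣_) (sym m∸m%n≡[m/n]*n) (n∣m*n (m / n)))
    where
    m∸m%n≡[m/n]*n : m ∸ m % n ≡ m / n * n
    m∸m%n≡[m/n]*n = begin
      m ∸ m % n                   ≡⟨ cong (_∸ m % n) (m≡m%n+[m/n]*n m n) ⟩
      m % n + m / n * n ∸ m % n   ≡⟨ m+n∸m≡n (m % n) (m / n * n) ⟩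
      m / n * n                   ∎
      where open ≡-Reasoning

  module _ (n-prime : Prime n) where

    private
      euclid : ∀ u v → Dvd (u ℤ.* v) → Dvd u ⊎ Dvd v
      euclid u v d with euclidsLemma ∣ u ∣ ∣ v ∣ n-prime (subst (n ∣_) (ℤ.abs-* u v) (ℤ.∣⇒∣ᵤ d))
      ... | inj₁ n∣u = inj₁ (ℤ.∣ᵤ⇒∣ n∣u)
      ... | inj₂ n∣v = inj₂ (ℤ.∣ᵤ⇒∣ n∣v)

      Dvd⇒≈0 : ∀ {x} → Dvd (+ x) → x ≈ 0
      Dvd⇒≈0 {x} d = fromDvd (subst Dvd (sym (ℤ.+-identityʳ (+ x))) d)

      difference-*ʳ : ∀ x y c → x ℤ.* c ℤ.- y ℤ.* c ≡ (x ℤ.- y) ℤ.* c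
      difference-*ʳ = solve-∀

      difference-1 : ∀ c x → c ℤ.* x ℤ.- x ≡ (c ℤ.- ℤ.1ℤ) ℤ.* x
      difference-1 = solve-∀

    1≉0 : ¬ 1 ≈ 0
    1≉0 e = contradiction (<-≈⇒≡ 1<n (<-trans (s≤s z≤n) 1<n) e) λ ()
      where
      1<n : 1 < n
      1<n = nonTrivial⇒n>1 n {{prime⇒nonTrivial n-prime}}

    *-cancelʳ-≈ : ∀ {c x y} → ¬ c ≈ 0 → x * c ≈ y * c → x ≈ y
    *-cancelʳ-≈ {c} {x} {y} c≉0 e =
      [ fromDvd {x} {y} , (λ d → contradiction (Dvd⇒≈0 d) c≉0) ]′ (euclid (+ x ℤ.- + y) (+ c) (subst Dvd factor (toDvd e)))
      where
      factor : + (x * c) ℤ.- + (y * c) ≡ (+ x ℤ.- + y) ℤ.* + c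
      factor rewrite ℤ.pos-* x c | ℤ.pos-* y c = difference-*ʳ (+ x) (+ y) (+ c)

    *-cancelˡ-≈ : ∀ {c x y} → ¬ c ≈ 0 → c * x ≈ c * y → x ≈ y
    *-cancelˡ-≈ {c} {x} {y} c≉0 e = *-cancelʳ-≈ c≉0 (≈-trans (≡⇒≈ (*-comm x c)) (≈-trans e (≡⇒≈ (*-comm c y))))

    *-fixed⇒≈0 : ∀ {c x} → ¬ c ≈ 1 → c * x ≈ x → x ≈ 0
    *-fixed⇒≈0 {c} {x} c≉1 e =
      [ (λ d → contradiction (fromDvd {c} {1} d) c≉1) , Dvd⇒≈0 ]′ (euclid (+ c ℤ.- + 1) (+ x) (subst Dvd factor (toDvd e)))
      where
      factor : + (c * x) ℤ.- + x ≡ (+ c ℤ.- + 1) ℤ.* + x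
      factor rewrite ℤ.pos-* c x = difference-1 (+ c) (+ x)

KernelInclusion : (n : ℕ) → Fin n → Fin n → Set
KernelInclusion n j₁ j₂ =
  ∀ (g : Fin n) → toℕ j₁ * toℕ g ≡ toℕ j₂ * toℕ g [mod n ] → toℕ j₁ * toℕ g ≡ 0 [mod n ]

≢0⇒1<n : ∀ {n} (j : Fin n) → toℕ j ≢ 0 → 1 < n
≢0⇒1<n j j≢0 = ≤-<-trans (n≢0⇒n>0 j≢0) (toℕ<n j)

module Character {p} (p-prime : Prime p) {n} .{{_ : NonZero n}} {ζ} (ζ-primitive : PrimitiveRoot p n ζ) where
  open Congruence p
  open Relation.Binary.Reasoning.Setoid ≈-setoid
  module Modn = Congruence n

  ζ^[n*k]≈1 : ∀ k → ζ ^ (n * k) ≈ 1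
  ζ^[n*k]≈1 k = begin
    ζ ^ (n * k)   ≡⟨ ^-*-assoc ζ n k ⟨
    (ζ ^ n) ^ k   ≈⟨ ^-cong k (congruent (proj₁ ζ-primitive)) ⟩
    1 ^ k         ≡⟨ ^-zeroˡ k ⟩
    1             ∎

  ζ^-inverse : ∀ A → ζ ^ A * ζ ^ (A * pred n) ≈ 1
  ζ^-inverse A = begin
    ζ ^ A * ζ ^ (A * pred n)   ≡⟨ ^-distribˡ-+-* ζ A (A * pred n) ⟨
    ζ ^ (A + A * pred n)       ≡⟨ cong (ζ ^_) (*-suc A (pred n)) ⟨
    ζ ^ (A * suc (pred n))     ≡⟨ cong (λ k → ζ ^ (A * k)) (suc-pred n) ⟩
    ζ ^ (A * n)                ≡⟨ cong (ζ ^_) (*-comm A n) ⟩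
    ζ ^ (n * A)                ≈⟨ ζ^[n*k]≈1 A ⟩
    1                          ∎

  ζ^-cancel : ∀ A t → ζ ^ A * (ζ ^ (A * pred n) * t) ≈ t
  ζ^-cancel A t = begin
    ζ ^ A * (ζ ^ (A * pred n) * t)   ≡⟨ *-assoc (ζ ^ A) (ζ ^ (A * pred n)) t ⟨
    ζ ^ A * ζ ^ (A * pred n) * t     ≈⟨ *-congʳ t (ζ^-inverse A) ⟩
    1 * t                            ≡⟨ *-identityˡ t ⟩
    t                                ∎

  ζ^≉0 : ∀ A → ¬ ζ ^ A ≈ 0
  ζ^≉0 A e = 1≉0 p-prime (≈-trans (≈-sym (ζ^-inverse A)) (*-cong e ≈-refl))

  ζ^≉1 : ∀ {k} → 0 < k → k < n → ¬ ζ ^ k ≈ 1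
  ζ^≉1 {k} 0<k k<n e = proj₂ ζ-primitive k 0<k k<n (≡[mod] e)

  ζ^A≈ζ^[A%n] : ∀ A → ζ ^ A ≈ ζ ^ (A % n)
  ζ^A≈ζ^[A%n] A = begin
    ζ ^ A                              ≡⟨ cong (ζ ^_) (trans (m≡m%n+[m/n]*n A n) (cong (_+_ (A % n)) (*-comm (A / n) n))) ⟩
    ζ ^ (A % n + n * (A / n))          ≡⟨ ^-distribˡ-+-* ζ (A % n) (n * (A / n)) ⟩
    ζ ^ (A % n) * ζ ^ (n * (A / n))    ≈⟨ *-congˡ (ζ ^ (A % n)) (ζ^[n*k]≈1 (A / n)) ⟩
    ζ ^ (A % n) * 1                    ≡⟨ *-identityʳ (ζ ^ (A % n)) ⟩
    ζ ^ (A % n)                        ∎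

  ζ^-injective-≤ : ∀ {A B} → A ≤ B → B < n → ζ ^ A ≈ ζ ^ B → A ≡ B
  ζ^-injective-≤ {A} {B} A≤B B<n e with B ∸ A ≟ 0
  ... | yes B∸A≡0 = ≤-antisym A≤B (m∸n≡0⇒m≤n B∸A≡0)
  ... | no B∸A≢0 = contradiction ζ^[B∸A]≈1 (ζ^≉1 (n≢0⇒n>0 B∸A≢0) (≤-<-trans (m∸n≤m B A) B<n))
    where
    ζ^[B∸A]≈1 : ζ ^ (B ∸ A) ≈ 1
    ζ^[B∸A]≈1 = *-cancelˡ-≈ p-prime (ζ^≉0 A) (begin
      ζ ^ A * ζ ^ (B ∸ A)   ≡⟨ ^-distribˡ-+-* ζ A (B ∸ A) ⟨
      ζ ^ (A + (B ∸ A))     ≡⟨ cong (ζ ^_) (m+[n∸m]≡n A≤B) ⟩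
      ζ ^ B                 ≈⟨ e ⟨
      ζ ^ A                 ≡⟨ *-identityʳ (ζ ^ A) ⟨
      ζ ^ A * 1             ∎)

  ζ^-injective : ∀ {A B} → A < n → B < n → ζ ^ A ≈ ζ ^ B → A ≡ B
  ζ^-injective {A} {B} A<n B<n e with ≤-total A B
  ... | inj₁ A≤B = ζ^-injective-≤ A≤B B<n e
  ... | inj₂ B≤A = sym (ζ^-injective-≤ B≤A A<n (≈-sym e))

  ζ^≈ζ^⇔ : ∀ A B → ζ ^ A ≈ ζ ^ B ⇔ A ≡ B [mod n ]
  ζ^≈ζ^⇔ A B = mk⇔ to from
    where
    to : ζ ^ A ≈ ζ ^ B → A ≡ B [mod n ]
    to e = Modn.≡[mod] (Modn.≈-trans (Modn.≈-sym (Modn.%-≈ A)) (Modn.≈-trans (Modn.≡⇒≈ A%n≡B%n) (Modn.%-≈ B)))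
      where
      A%n≡B%n : A % n ≡ B % n
      A%n≡B%n = ζ^-injective (m%n<n A n) (m%n<n B n) (≈-trans (≈-sym (ζ^A≈ζ^[A%n] A)) (≈-trans e (ζ^A≈ζ^[A%n] B)))
    from : A ≡ B [mod n ] → ζ ^ A ≈ ζ ^ B
    from e = begin
      ζ ^ A         ≈⟨ ζ^A≈ζ^[A%n] A ⟩
      ζ ^ (A % n)   ≡⟨ cong (ζ ^_) A%n≡B%n ⟩
      ζ ^ (B % n)   ≈⟨ ζ^A≈ζ^[A%n] B ⟨
      ζ ^ B         ∎
      where
      A%n≡B%n : A % n ≡ B % n
      A%n≡B%n = Modn.<-≈⇒≡ (m%n<n A n) (m%n<n B n)
        (Modn.≈-trans (Modn.%-≈ A) (Modn.≈-trans (Modn.congruent e) (Modn.≈-sym (Modn.%-≈ B))))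

  1,a∈Line : ∀ a → Line p a (1 , a)
  1,a∈Line a = 1 , ≡[mod] (≈-refl {1}) , ≡[mod] (≡⇒≈ (sym (*-identityˡ a)))

  χ-fixed⇒≈0 : ∀ (j g : Fin n) {x} → toℕ j ≢ 0 → toℕ g ≡ 1 → ζ ^ (toℕ j * toℕ g) * x ≈ x → x ≈ 0
  χ-fixed⇒≈0 j g j≢0 g≡1 e rewrite g≡1 | *-identityʳ (toℕ j) =
    *-fixed⇒≈0 p-prime (ζ^≉1 (n≢0⇒n>0 j≢0) (toℕ<n j)) e

  module _ (j₁ j₂ : Fin n) where

    private
      ρ : Fin n → V2 → V2
      ρ = χ⊕χ ζ j₁ j₂

      e₁ e₂ : Fin n → ℕ
      e₁ g = toℕ j₁ * toℕ g
      e₂ g = toℕ j₂ * toℕ g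

    condB⇔ : CondB p n ρ ⇔ (toℕ j₁ ≢ 0 × toℕ j₂ ≢ 0)
    condB⇔ = mk⇔ (λ B → condB⇒j₁≢0 B , condB⇒j₂≢0 B) λ (j₁≢0 , j₂≢0) → nonzero⇒condB j₁≢0 j₂≢0
      where
      condB⇒j₁≢0 : CondB p n ρ → toℕ j₁ ≢ 0
      condB⇒j₁≢0 B j₁≡0 = 1≉0 p-prime (congruent (proj₁ (B (1 , 0) e₁-fixed)))
        where
        e₁-fixed : ∀ g → ρ g (1 , 0) ≈[ p ] (1 , 0)
        e₁-fixed g rewrite j₁≡0 = ≡[mod] (≈-refl {1}) , ≡[mod] (≡⇒≈ (*-zeroʳ (ζ ^ e₂ g)))
      condB⇒j₂≢0 : CondB p n ρ → toℕ j₂ ≢ 0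
      condB⇒j₂≢0 B j₂≡0 = 1≉0 p-prime (congruent (proj₂ (B (0 , 1) e₂-fixed)))
        where
        e₂-fixed : ∀ g → ρ g (0 , 1) ≈[ p ] (0 , 1)
        e₂-fixed g rewrite j₂≡0 = ≡[mod] (≡⇒≈ (*-zeroʳ (ζ ^ e₁ g))) , ≡[mod] (≈-refl {1})
      nonzero⇒condB : toℕ j₁ ≢ 0 → toℕ j₂ ≢ 0 → CondB p n ρ
      nonzero⇒condB j₁≢0 j₂≢0 (x , y) fixed =
        ≡[mod] (χ-fixed⇒≈0 j₁ g₁ j₁≢0 g₁≡1 (congruent (proj₁ (fixed g₁)))) ,
        ≡[mod] (χ-fixed⇒≈0 j₂ g₁ j₂≢0 g₁≡1 (congruent (proj₂ (fixed g₁))))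
        where
        1<n : 1 < n
        1<n = ≢0⇒1<n j₁ j₁≢0
        g₁ : Fin n
        g₁ = fromℕ< 1<n
        g₁≡1 : toℕ g₁ ≡ 1
        g₁≡1 = toℕ-fromℕ< 1<n

    stabilizes⇔ : ∀ {a} → ¬ (a ≡ 0 [mod p ]) → ∀ g → Stabilizes p n ρ (Line p a) g ⇔ ζ ^ e₁ g ≈ ζ ^ e₂ g
    stabilizes⇔ {a} a≢0 g = mk⇔ stabilizes⇒ (λ E → into E , onto E)
      where
      stabilizes⇒ : Stabilizes p n ρ (Line p a) g → ζ ^ e₁ g ≈ ζ ^ e₂ g
      stabilizes⇒ (into , _) with into (1 , a) (1,a∈Line a)
      ... | t , ζ^e₁≈t , ζ^e₂a≈ta = ≈-sym (*-cancelʳ-≈ p-prime (λ a≈0 → a≢0 (≡[mod] a≈0)) (begin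
        ζ ^ e₂ g * a         ≈⟨ congruent ζ^e₂a≈ta ⟩
        t * a                ≈⟨ *-congʳ a (congruent {ζ ^ e₁ g * 1} {t} ζ^e₁≈t) ⟨
        ζ ^ e₁ g * 1 * a     ≡⟨ cong (_* a) (*-identityʳ (ζ ^ e₁ g)) ⟩
        ζ ^ e₁ g * a         ∎))
      into : ζ ^ e₁ g ≈ ζ ^ e₂ g → ∀ v → Line p a v → Line p a (ρ g v)
      into E (x , y) (t , x≈t , y≈ta) = ζ ^ e₁ g * t , ≡[mod] (*-congˡ (ζ ^ e₁ g) (congruent x≈t)) , ≡[mod] (begin
        ζ ^ e₂ g * y         ≈⟨ *-cong (≈-sym E) (congruent y≈ta) ⟩
        ζ ^ e₁ g * (t * a)   ≡⟨ *-assoc (ζ ^ e₁ g) t a ⟨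
        ζ ^ e₁ g * t * a     ∎)
      onto : ζ ^ e₁ g ≈ ζ ^ e₂ g → ∀ w → Line p a w → Σ V2 λ v → Line p a v × (ρ g v ≈[ p ] w)
      onto E (x , y) (t , x≈t , y≈ta) =
        (c * t , c * t * a) , (c * t , ≡[mod] (≈-refl {c * t}) , ≡[mod] (≈-refl {c * t * a})) ,
        ≡[mod] (≈-trans (ζ^-cancel (e₁ g) t) (≈-sym (congruent x≈t))) , ≡[mod] (begin
          ζ ^ e₂ g * (c * t * a)     ≈⟨ *-cong (≈-sym E) (≡⇒≈ (*-assoc c t a)) ⟩
          ζ ^ e₁ g * (c * (t * a))   ≈⟨ ζ^-cancel (e₁ g) (t * a) ⟩
          t * a                      ≈⟨ congruent y≈ta ⟨
          y                          ∎)
        where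
        c : ℕ
        c = ζ ^ (e₁ g * pred n)

    condC⇔ : ∀ {a} → ¬ (a ≡ 0 [mod p ]) → CondC p n ρ (Line p a) ⇔ KernelInclusion n j₁ j₂
    condC⇔ {a} a≢0 = mk⇔ condC⇒ condC
      where
      condC⇒ : CondC p n ρ (Line p a) → KernelInclusion n j₁ j₂
      condC⇒ C g e₁≡e₂ = Equivalence.to (ζ^≈ζ^⇔ (e₁ g) 0) (begin
        ζ ^ e₁ g       ≡⟨ *-identityʳ (ζ ^ e₁ g) ⟨
        ζ ^ e₁ g * 1   ≈⟨ congruent (proj₁ (C g stabilizes (1 , a) (1,a∈Line a))) ⟩
        1              ∎)
        where
        stabilizes : Stabilizes p n ρ (Line p a) g
        stabilizes = Equivalence.from (stabilizes⇔ a≢0 g) (Equivalence.from (ζ^≈ζ^⇔ (e₁ g) (e₂ g)) e₁≡e₂)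
      condC : KernelInclusion n j₁ j₂ → CondC p n ρ (Line p a)
      condC K g stabilizes (x , y) _ = ≡[mod] (ζ^≈1-fixes (e₁ g) x ζ^e₁≈1) , ≡[mod] (ζ^≈1-fixes (e₂ g) y ζ^e₂≈1)
        where
        ζ^e₁≈ζ^e₂ : ζ ^ e₁ g ≈ ζ ^ e₂ g
        ζ^e₁≈ζ^e₂ = Equivalence.to (stabilizes⇔ a≢0 g) stabilizes
        ζ^e₁≈1 : ζ ^ e₁ g ≈ 1
        ζ^e₁≈1 = Equivalence.from (ζ^≈ζ^⇔ (e₁ g) 0) (K g (Equivalence.to (ζ^≈ζ^⇔ (e₁ g) (e₂ g)) ζ^e₁≈ζ^e₂))
        ζ^e₂≈1 : ζ ^ e₂ g ≈ 1
        ζ^e₂≈1 = ≈-trans (≈-sym ζ^e₁≈ζ^e₂) ζ^e₁≈1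
        ζ^≈1-fixes : ∀ A z → ζ ^ A ≈ 1 → ζ ^ A * z ≈ z
        ζ^≈1-fixes A z e = ≈-trans (*-congʳ z e) (≡⇒≈ (*-identityˡ z))

    condB×condC⇔ : ∀ {a} → ¬ (a ≡ 0 [mod p ]) →
      (CondB p n ρ × CondC p n ρ (Line p a)) ⇔ ((toℕ j₁ ≢ 0 × toℕ j₂ ≢ 0) × KernelInclusion n j₁ j₂)
    condB×condC⇔ a≢0 = condB⇔ ×-⇔ condC⇔ a≢0

kernelInclusion⇔≢ : ∀ {ℓ} → Prime ℓ → (j₁ j₂ : Fin ℓ) → toℕ j₁ ≢ 0 →
  KernelInclusion ℓ j₁ j₂ ⇔ j₁ ≢ j₂
kernelInclusion⇔≢ {ℓ} ℓ-prime j₁ j₂ j₁≢0 = mk⇔ kernelInclusion⇒≢ ≢⇒kernelInclusion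
  where
  open Congruence ℓ
  <-≈0⇒≡0 : ∀ (j : Fin ℓ) → toℕ j ≈ 0 → toℕ j ≡ 0
  <-≈0⇒≡0 j = <-≈⇒≡ (toℕ<n j) (≤-<-trans z≤n (toℕ<n j))
  kernelInclusion⇒≢ : KernelInclusion ℓ j₁ j₂ → j₁ ≢ j₂
  kernelInclusion⇒≢ K refl = j₁≢0 (<-≈0⇒≡0 j₁ j₁≈0)
    where
    1<ℓ : 1 < ℓ
    1<ℓ = ≢0⇒1<n j₁ j₁≢0
    j₁≈0 : toℕ j₁ ≈ 0
    j₁≈0 with K (fromℕ< 1<ℓ) (≡[mod] (≈-refl {toℕ j₁ * toℕ (fromℕ< 1<ℓ)}))
    ... | j₁*1≡0 rewrite toℕ-fromℕ< 1<ℓ | *-identityʳ (toℕ j₁) = congruent j₁*1≡0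
  ≢⇒kernelInclusion : j₁ ≢ j₂ → KernelInclusion ℓ j₁ j₂
  ≢⇒kernelInclusion j₁≢j₂ g e with toℕ g ≟ 0
  ... | yes g≡0 rewrite g≡0 | *-zeroʳ (toℕ j₁) = ≡[mod] (≈-refl {0})
  ... | no g≢0 = contradiction (toℕ-injective (<-≈⇒≡ (toℕ<n j₁) (toℕ<n j₂) j₁≈j₂)) j₁≢j₂
    where
    j₁≈j₂ : toℕ j₁ ≈ toℕ j₂
    j₁≈j₂ = *-cancelʳ-≈ ℓ-prime (λ g≈0 → g≢0 (<-≈0⇒≡0 g g≈0)) (congruent e)

nonzero×kernelInclusion⇔-prime : ∀ {ℓ} → Prime ℓ → (j₁ j₂ : Fin ℓ) →
  ((toℕ j₁ ≢ 0 × toℕ j₂ ≢ 0) × KernelInclusion ℓ j₁ j₂) ⇔ (toℕ j₁ ≢ 0 × toℕ j₂ ≢ 0 × j₁ ≢ j₂)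
nonzero×kernelInclusion⇔-prime ℓ-prime j₁ j₂ = mk⇔
  (λ ((j₁≢0 , j₂≢0) , K) → j₁≢0 , j₂≢0 , Equivalence.to (kernelInclusion⇔≢ ℓ-prime j₁ j₂ j₁≢0) K)
  (λ (j₁≢0 , j₂≢0 , j₁≢j₂) → (j₁≢0 , j₂≢0) , Equivalence.from (kernelInclusion⇔≢ ℓ-prime j₁ j₂ j₁≢0) j₁≢j₂)

infix 4 _≡?_[mod_]
_≡?_[mod_] : ∀ x y n → Dec (x ≡ y [mod n ])
x ≡? y [mod n ] = n ∣? ∣ + x ℤ.- + y ∣

kernelInclusion? : ∀ n (j₁ j₂ : Fin n) → Dec (KernelInclusion n j₁ j₂)
kernelInclusion? n j₁ j₂ =
  all? λ g → (toℕ j₁ * toℕ g ≡? toℕ j₂ * toℕ g [mod n ]) →-dec (toℕ j₁ * toℕ g ≡? 0 [mod n ])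

_⇔?_ : ∀ {A B : Set} → Dec A → Dec B → Dec (A ⇔ B)
A? ⇔? B? =
  map′ (λ (f , g) → mk⇔ f g) (λ e → Equivalence.to e , Equivalence.from e) ((A? →-dec B?) ×-dec (B? →-dec A?))

nonzero×kernelInclusion⇔-4 : ∀ (j₁ j₂ : Fin 4) →
  ((toℕ j₁ ≢ 0 × toℕ j₂ ≢ 0) × KernelInclusion 4 j₁ j₂) ⇔
  (j₁ ≢ zero × j₂ ≢ zero × j₁ ≢ j₂ × toℕ j₁ ≢ (toℕ j₂ + 2) % 4)
nonzero×kernelInclusion⇔-4 = toWitness {a? = all? λ j₁ → all? λ j₂ → lhs? j₁ j₂ ⇔? rhs? j₁ j₂} _
  where
  lhs? : ∀ (j₁ j₂ : Fin 4) → Dec ((toℕ j₁ ≢ 0 × toℕ j₂ ≢ 0) × KernelInclusion 4 j₁ j₂)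
  lhs? j₁ j₂ = (¬? (toℕ j₁ ≟ 0) ×-dec ¬? (toℕ j₂ ≟ 0)) ×-dec kernelInclusion? 4 j₁ j₂
  rhs? : ∀ (j₁ j₂ : Fin 4) → Dec (j₁ ≢ zero × j₂ ≢ zero × j₁ ≢ j₂ × toℕ j₁ ≢ (toℕ j₂ + 2) % 4)
  rhs? j₁ j₂ =
    ¬? (j₁ Fin.≟ zero) ×-dec ¬? (j₂ Fin.≟ zero) ×-dec ¬? (j₁ Fin.≟ j₂) ×-dec ¬? (toℕ j₁ ≟ (toℕ j₂ + 2) % 4)

-- The hypotheses 5 ≤ p, ℓ ≢ 2, ℓ ∣ p − 1 and p ≡ 1 (mod 4) only ensure that ζ exists.
proposition5p6 : (p : ℕ) → Prime p → 5 ≤ p →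
    ((ℓ : ℕ) → Prime ℓ → ℓ ≢ 2 → ℓ ∣ (p ∸ 1) →
      (ζ : ℕ) → PrimitiveRoot p ℓ ζ →
      (j₁ j₂ : Fin ℓ) → (a : ℕ) → ¬ (a ≡ 0 [mod p ]) →
      ((CondB p ℓ (χ⊕χ ζ j₁ j₂) × CondC p ℓ (χ⊕χ ζ j₁ j₂) (Line p a))
        ⇔ ((toℕ j₁ ≢ 0) × (toℕ j₂ ≢ 0) × (j₁ ≢ j₂))))
    ×
    (p % 4 ≡ 1 →
      (ζ : ℕ) → PrimitiveRoot p 4 ζ →
      (j₁ j₂ : Fin 4) → (a : ℕ) → ¬ (a ≡ 0 [mod p ]) →
      ((CondB p 4 (χ⊕χ ζ j₁ j₂) × CondC p 4 (χ⊕χ ζ j₁ j₂) (Line p a))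
        ⇔ ((j₁ ≢ zero) × (j₂ ≢ zero) × (j₁ ≢ j₂) × (toℕ j₁ ≢ (toℕ j₂ + 2) % 4))))
proposition5p6 p p-prime _ =
  (λ ℓ ℓ-prime _ _ ζ ζ-primitive j₁ j₂ _ a≢0 →
    nonzero×kernelInclusion⇔-prime ℓ-prime j₁ j₂
      ⇔-∘ Character.condB×condC⇔ p-prime {{prime⇒nonZero ℓ-prime}} ζ-primitive j₁ j₂ a≢0) ,
  (λ _ ζ ζ-primitive j₁ j₂ _ a≢0 →
    nonzero×kernelInclusion⇔-4 j₁ j₂ ⇔-∘ Character.condB×condC⇔ p-prime ζ-primitive j₁ j₂ a≢0)
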